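{- Let $G^v$ and $H^w$ be finite simple rooted graphs (rooted at $v$ and $w$ respectively). For all integers $k \geq 2$, \[ I\bigl((G^v:H^w)_k;x\bigr) = \bigl( I(H\setminus w;x) + I(H;x) \bigr)\, I\bigl((G^v:H^w)_{k-1};x\bigr) - I(H\setminus w;x)\,I(H;x)\, I\bigl((G^v:H^w)_{k-2};x\bigr). \] That is, the sequence $\bigl(I((G^v:H^w)_k;x)\bigr)_{k\ge 0}$ satisfies a linear recurrence with characteristic polynomial $\chi(r) = \bigl(r - I(H\setminus w;x)\bigr)\bigl(r - I(H;x)\bigr)$.
   Context: All graphs are finite and simple. The independence polynomial of a graph $G$ is $I(G;x)=\sum_{i\ge 0} s_i x^i$, where $s_i$ is the number of independent sets of size $i$ in $G$ (so $s_0=1$, and the empty graph has independence polynomial $1$). A rooted graph $G^v$ is a graph $G$ with a distinguished vertex $v$. $G\setminus v$ denotes $G$ with $v$ deleted, and $G\setminus N[v]$ denotes $G$ with the closed neighborhood of $v$ deleted. For a rooted graph $H^w$ and an integer $k\ge 0$, the scale graph $Z_k(H^w)$ is obtained by taking a new vertex $v_0$ and $k$ disjoint copies of $H$ and joining $v_0$ to the root $w$ of each copy. For disjoint rooted graphs $G^v,H^w$, the graph $(G^v:H^w)_k$ is the disjoint union of $G$ and $Z_k(H^w)$ together with the edge joining $v$ to $v_0$; it is regarded as rooted at $v$. A sequence $(p_k)_{k\ge0}$ satisfies the linear recurrence with characteristic polynomial $r^n - c_{n-1}r^{n-1}-\cdots-c_0$ if $p_k = c_{n-1}p_{k-1}+\cdots+c_0p_{k-n}$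 for all $k\ge n$. -}

module Defs where

open import Data.Bool using (Bool; true; false; _∧_; _∨_; if_then_else_)
open import Data.Nat using (ℕ; zero; suc; _+_; _*_; _∸_)
import Data.Nat as ℕ
open import Data.Fin using (Fin; zero; suc; splitAt; remQuot; punchIn; _≟_)
open import Data.Sum using (inj₁; inj₂)
open import Data.Product using (_×_; _,_)
open import Data.Vec using (Vec; []; _∷_; lookup)
open import Data.List using (List; []; _∷_; map; _++_; length; filter; upTo; allFin)
open import Data.Integer using (ℤ; +_) renaming (_+_ to _+ℤ_; _*_ to _*ℤ_; _-_ to _-ℤ_)
import Data.Integer as ℤ
open import Relation.Nullary.Decidable using (⌊_⌋)
open import Relation.Binary.PropositionalEquality using (_≡_)

record Graph : Set where
  constructor mkGraph
  field
    n   : ℕ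
    adj : Fin n → Fin n → Bool
open Graph public

IsSimple : Graph → Set
IsSimple G = (∀ u v → adj G u v ≡ adj G v u) × (∀ u → adj G u u ≡ false)

record RootedGraph : Set where
  constructor rooted
  field
    graph : Graph
    root  : Fin (n graph)
open RootedGraph public

Poly : Set
Poly = ℕ → ℤ

_+P_ : Poly → Poly → Poly
(p +P q) i = p i +ℤ q i

_-P_ : Poly → Poly → Poly
(p -P q) i = p i -ℤ q i

sumℤ : List ℤ → ℤ
sumℤ [] = + 0
sumℤ (x ∷ xs) = x +ℤ sumℤ xs

_*P_ : Poly → Poly → Poly
(p *P q) k = sumℤ (map (λ i → p i *ℤ q (k ∸ i)) (upTo (suc k)))

subsets : (m : ℕ) → List (Vec Bool m)
subsets zero = [] ∷ []
subsets (suc m) = map (true ∷_) (subsets m) ++ map (false ∷_) (subsets m)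

size : ∀ {m} → Vec Bool m → ℕ
size [] = 0
size (true ∷ s) = suc (size s)
size (false ∷ s) = size s

not : Bool → Bool
not true = false
not false = true

allB : ∀ {A : Set} → (A → Bool) → List A → Bool
allB f [] = true
allB f (x ∷ xs) = f x ∧ allB f xs

-- S is independent: no two (not necessarily distinct) members are adjacent.
isIndependent : (G : Graph) → Vec Bool (n G) → Bool
isIndependent G s =
  allB (λ u → allB (λ v → not (lookup s u ∧ lookup s v ∧ adj G u v)) (allFin (n G))) (allFin (n G))

countTrue : ∀ {A : Set} → (A → Bool) → List A → ℕ
countTrue f [] = 0
countTrue f (x ∷ xs) = if f x then suc (countTrue f xs) else countTrue f xs

indepCount : Graph → ℕ → ℕ
indepCount G i =
  countTrue (λ s → ⌊ size s ℕ.≟ i ⌋ ∧ isIndependent G s) (subsets (n G))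

I : Graph → Poly
I G i = + indepCount G i

eqF : ∀ {m} → Fin m → Fin m → Bool
eqF a b = ⌊ a ≟ b ⌋

deleteV : (G : Graph) → Fin (n G) → Graph
deleteV (mkGraph zero a) ()
deleteV (mkGraph (suc m) a) v = mkGraph m (λ i j → a (punchIn v i) (punchIn v j))

joinByEdge : (G : Graph) → Fin (n G) → (H : Graph) → Fin (n H) → Graph
joinByEdge G a H b = mkGraph (n G + n H) e
  where
  e : Fin (n G + n H) → Fin (n G + n H) → Bool
  e x y with splitAt (n G) x | splitAt (n G) y
  ... | inj₁ x' | inj₁ y' = adj G x' y'
  ... | inj₂ x' | inj₂ y' = adj H x' y'
  ... | inj₁ x' | inj₂ y' = eqF x' a ∧ eqF y' b
  ... | inj₂ x' | inj₁ y' = eqF x' b ∧ eqF y' a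

-- k disjoint copies of H (vertex (j , u) of copy j is encoded via remQuot)
copies : ℕ → Graph → Graph
copies k H = mkGraph (k * n H) e
  where
  e : Fin (k * n H) → Fin (k * n H) → Bool
  e x y with remQuot {k} (n H) x | remQuot {k} (n H) y
  ... | (j , u) | (j' , u') = eqF j j' ∧ adj H u u'

-- scale graph Z_k(H^w): new vertex v₀ (= zero) joined to the root of each of k copies of H
scale : ℕ → RootedGraph → Graph
scale k (rooted H w) = mkGraph (suc (k * n H)) e
  where
  e : Fin (suc (k * n H)) → Fin (suc (k * n H)) → Bool
  e zero zero = false
  e zero (suc y) with remQuot {k} (n H) y
  ... | (_ , u) = eqF u w
  e (suc x) zero with remQuot {k} (n H) x
  ... | (_ , u) = eqF u w
  e (suc x) (suc y) = adj (copies k H) x y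

-- (G^v : H^w)_k : disjoint union of G and Z_k(H^w) plus the edge v v₀
colon : RootedGraph → RootedGraph → ℕ → Graph
colon (rooted G v) H k = joinByEdge G v (scale k H) zero

{-# OPTIONS --safe #-}
module Submission where

-- Split the independent sets of (G^v : H^w)_k according to whether they contain the centre v₀
-- of the scale graph. Those containing v₀ are an independent set of G avoiding v, plus v₀, plus
-- in each copy of H an independent set avoiding w; the others are an independent set of G plus
-- in each copy of H any independent set. Hence I((G^v : H^w)_k) = α I(H∖w)^k + β I(H)^k, and
-- any sum of two geometric sequences with ratios a and b satisfies the linear recurrence with
-- characteristic polynomial (r - a)(r - b). As polynomials are coefficient sequences ℕ → ℤ, this
-- algebra takes place in the commutative ring they form under the Cauchy product.

open import Defs
open import Data.Nat using (ℕ; _≤_; _∸_)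
open import Relation.Binary.PropositionalEquality using (_≡_)

open import Algebra.Bundles using (CommutativeRing; CommutativeSemiring)
open import Function using (_∘_)

module PowerSeries where
  open import Level using (0ℓ)
  import Algebra.Construct.Pointwise as Pointwise
  open import Data.Nat using (zero; suc; _<_; _≡ᵇ_; s≤s; z≤n)
  import Data.Nat as ℕ
  import Data.Nat.Properties as ℕP
  open import Data.Integer using (ℤ; 0ℤ; 1ℤ; -_; _+_; _*_)
  import Data.Integer.Properties as ℤ
  open import Data.Integer.Tactic.RingSolver using (solve-∀)
  open import Data.Bool using (if_then_else_)
  open import Data.List using (map; applyUpTo)
  open import Data.Product using (_,_)
  open import Relation.Binary.PropositionalEquality
    using (refl; sym; trans; cong; cong₂; module ≡-Reasoning)

  infix 4 _≈_
  _≈_ : Poly → Poly → Set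
  p ≈ q = ∀ i → p i ≡ q i

  ∑< : ℕ → (ℕ → ℤ) → ℤ
  ∑< zero    f = 0ℤ
  ∑< (suc n) f = f 0 + ∑< n (f ∘ suc)

  sumℤ-applyUpTo : ∀ (g : ℕ → ℤ) (f : ℕ → ℕ) n → sumℤ (map g (applyUpTo f n)) ≡ ∑< n (g ∘ f)
  sumℤ-applyUpTo g f zero    = refl
  sumℤ-applyUpTo g f (suc n) = cong (g (f 0) +_) (sumℤ-applyUpTo g (f ∘ suc) n)

  ∑<-cong< : ∀ n {f g : ℕ → ℤ} → (∀ i → i < n → f i ≡ g i) → ∑< n f ≡ ∑< n g
  ∑<-cong< zero    eq = refl
  ∑<-cong< (suc n) eq = cong₂ _+_ (eq 0 (s≤s z≤n)) (∑<-cong< n (λ i i<n → eq (suc i) (s≤s i<n)))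

  ∑<-cong : ∀ n {f g : ℕ → ℤ} → (∀ i → f i ≡ g i) → ∑< n f ≡ ∑< n g
  ∑<-cong n eq = ∑<-cong< n (λ i _ → eq i)

  ∑<-+ : ∀ n (f g : ℕ → ℤ) → ∑< n (λ i → f i + g i) ≡ ∑< n f + ∑< n g
  ∑<-+ zero    f g = refl
  ∑<-+ (suc n) f g = trans (cong (f 0 + g 0 +_) (∑<-+ n (f ∘ suc) (g ∘ suc)))
                           (interchange (f 0) (g 0) _ _)
    where
    interchange : ∀ a b c d → a + b + (c + d) ≡ a + c + (b + d)
    interchange = solve-∀

  *-distribˡ-∑< : ∀ n c (f : ℕ → ℤ) → c * ∑< n f ≡ ∑< n (λ i → c * f i)
  *-distribˡ-∑< zero    c f = ℤ.*-zeroʳ c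
  *-distribˡ-∑< (suc n) c f =
    trans (ℤ.*-distribˡ-+ c (f 0) _) (cong (c * f 0 +_) (*-distribˡ-∑< n c (f ∘ suc)))

  ∑<-zero : ∀ n → ∑< n (λ _ → 0ℤ) ≡ 0ℤ
  ∑<-zero zero    = refl
  ∑<-zero (suc n) = trans (ℤ.+-identityˡ _) (∑<-zero n)

  ∑<-last : ∀ n (f : ℕ → ℤ) → ∑< (suc n) f ≡ ∑< n f + f n
  ∑<-last zero    f = ℤ.+-comm (f 0) (0ℤ)
  ∑<-last (suc n) f = trans (cong (f 0 +_) (∑<-last n (f ∘ suc))) (sym (ℤ.+-assoc (f 0) _ _))

  ∑<-reverse : ∀ n (f : ℕ → ℤ) → ∑< n f ≡ ∑< n (λ i → f (n ∸ suc i))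
  ∑<-reverse zero    f = refl
  ∑<-reverse (suc n) f = begin
    f 0 + ∑< n (f ∘ suc)                    ≡⟨ cong (f 0 +_) (∑<-reverse n (f ∘ suc)) ⟩
    f 0 + ∑< n (λ i → f (suc (n ∸ suc i)))  ≡⟨ ℤ.+-comm (f 0) _ ⟩
    ∑< n (λ i → f (suc (n ∸ suc i))) + f 0  ≡⟨ cong₂ _+_ (∑<-cong< n (λ i i<n → cong f (sym (ℕP.+-∸-assoc 1 i<n))))
                                                        (cong f (sym (ℕP.n∸n≡0 n))) ⟩
    ∑< n (λ i → f (n ∸ i)) + f (n ∸ n)      ≡⟨ sym (∑<-last n (λ i → f (n ∸ i))) ⟩
    ∑< (suc n) (λ i → f (n ∸ i))            ∎
    where open ≡-Reasoning

  infixl 7 _⋆_ _·_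

  _⋆_ : Poly → Poly → Poly
  (p ⋆ q) k = ∑< (suc k) (λ i → p i * q (k ∸ i))

  *P≈⋆ : ∀ p q → p *P q ≈ p ⋆ q
  *P≈⋆ p q k = sumℤ-applyUpTo (λ i → p i * q (k ∸ i)) (λ i → i) (suc k)

  _·_ : ℤ → Poly → Poly
  (c · p) i = c * p i

  X^_ : ℕ → Poly
  (X^ a) i = if a ≡ᵇ i then 1ℤ else 0ℤ

  shift : Poly → Poly
  shift p i = p (suc i)

  ⋆-cong : ∀ {p p′ q q′} → p ≈ p′ → q ≈ q′ → p ⋆ q ≈ p′ ⋆ q′
  ⋆-cong p≈p′ q≈q′ k = ∑<-cong (suc k) (λ i → cong₂ _*_ (p≈p′ i) (q≈q′ (k ∸ i)))

  ⋆-distribʳ : ∀ p q r → (q +P r) ⋆ p ≈ (q ⋆ p) +P (r ⋆ p)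
  ⋆-distribʳ p q r k =
    trans (∑<-cong (suc k) (λ i → ℤ.*-distribʳ-+ (p (k ∸ i)) (q i) (r i)))
          (∑<-+ (suc k) (λ i → q i * p (k ∸ i)) (λ i → r i * p (k ∸ i)))

  ⋆-distribˡ : ∀ p q r → p ⋆ (q +P r) ≈ (p ⋆ q) +P (p ⋆ r)
  ⋆-distribˡ p q r k =
    trans (∑<-cong (suc k) (λ i → ℤ.*-distribˡ-+ (p i) (q (k ∸ i)) (r (k ∸ i))))
          (∑<-+ (suc k) (λ i → p i * q (k ∸ i)) (λ i → p i * r (k ∸ i)))

  ·-⋆ : ∀ c p q → (c · p) ⋆ q ≈ c · (p ⋆ q)
  ·-⋆ c p q k = trans (∑<-cong (suc k) (λ i → ℤ.*-assoc c (p i) (q (k ∸ i))))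
                      (sym (*-distribˡ-∑< (suc k) c (λ i → p i * q (k ∸ i))))

  ⋆-comm : ∀ p q → p ⋆ q ≈ q ⋆ p
  ⋆-comm p q k = begin
    ∑< (suc k) (λ i → p i * q (k ∸ i))              ≡⟨ ∑<-reverse (suc k) (λ i → p i * q (k ∸ i)) ⟩
    ∑< (suc k) (λ i → p (k ∸ i) * q (k ∸ (k ∸ i)))  ≡⟨ ∑<-cong< (suc k) swap ⟩
    ∑< (suc k) (λ i → q i * p (k ∸ i))              ∎
    where
    open ≡-Reasoning
    swap : ∀ i → i < suc k → p (k ∸ i) * q (k ∸ (k ∸ i)) ≡ q i * p (k ∸ i)
    swap i (s≤s i≤k) = trans (cong (λ j → p (k ∸ i) * q j) (ℕP.m∸[m∸n]≡n i≤k)) (ℤ.*-comm (p (k ∸ i)) (q i))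

  -- By induction on the degree: shift (p ⋆ q) is p 0 · shift q +P shift p ⋆ q definitionally.
  ⋆-assoc : ∀ p q r → (p ⋆ q) ⋆ r ≈ p ⋆ (q ⋆ r)
  ⋆-assoc p q r zero = ring (p 0) (q 0) (r 0)
    where
    ring : ∀ a b c → (a * b + 0ℤ) * c + 0ℤ ≡ a * (b * c + 0ℤ) + 0ℤ
    ring = solve-∀
  ⋆-assoc p q r (suc k) = begin
    (p ⋆ q) 0 * r (suc k) + (shift (p ⋆ q) ⋆ r) k
      ≡⟨ cong ((p ⋆ q) 0 * r (suc k) +_) (⋆-distribʳ r (p 0 · shift q) (shift p ⋆ q) k) ⟩
    (p ⋆ q) 0 * r (suc k) + (((p 0 · shift q) ⋆ r) k + ((shift p ⋆ q) ⋆ r) k)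
      ≡⟨ cong₂ (λ x y → (p ⋆ q) 0 * r (suc k) + (x + y)) (·-⋆ (p 0) (shift q) r k) (⋆-assoc (shift p) q r k) ⟩
    (p 0 * q 0 + 0ℤ) * r (suc k) + (p 0 * (shift q ⋆ r) k + (shift p ⋆ (q ⋆ r)) k)
      ≡⟨ ring (p 0) (q 0) (r (suc k)) ((shift q ⋆ r) k) ((shift p ⋆ (q ⋆ r)) k) ⟩
    p 0 * (q 0 * r (suc k) + (shift q ⋆ r) k) + (shift p ⋆ (q ⋆ r)) k
      ∎
    where
    open ≡-Reasoning
    ring : ∀ a b c d e → (a * b + 0ℤ) * c + (a * d + e) ≡ a * (b * c + d) + e
    ring = solve-∀

  ⋆-identityˡ : ∀ q → X^ 0 ⋆ q ≈ q
  ⋆-identityˡ q zero    = trans (ℤ.+-identityʳ _) (ℤ.*-identityˡ (q 0))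
  ⋆-identityˡ q (suc k) =
    trans (cong₂ _+_ (ℤ.*-identityˡ (q (suc k))) (∑<-zero (suc k))) (ℤ.+-identityʳ _)

  ⋆-identityʳ : ∀ q → q ⋆ X^ 0 ≈ q
  ⋆-identityʳ q k = trans (⋆-comm q (X^ 0) k) (⋆-identityˡ q k)

  X^-+ : ∀ a b → X^ a ⋆ X^ b ≈ X^ (a ℕ.+ b)
  X^-+ zero    b k       = ⋆-identityˡ (X^ b) k
  X^-+ (suc a) b zero    = refl
  X^-+ (suc a) b (suc k) = begin
    0ℤ * (X^ b) (suc k) + (X^ a ⋆ X^ b) k  ≡⟨ cong (_+ (X^ a ⋆ X^ b) k) (ℤ.*-zeroˡ ((X^ b) (suc k))) ⟩
    0ℤ + (X^ a ⋆ X^ b) k                  ≡⟨ ℤ.+-identityˡ _ ⟩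
    (X^ a ⋆ X^ b) k                       ≡⟨ X^-+ a b k ⟩
    (X^ (a ℕ.+ b)) k                      ∎
    where open ≡-Reasoning

  commutativeRing : CommutativeRing 0ℓ 0ℓ
  commutativeRing = record
    { Carrier           = Poly
    ; _≈_               = _≈_
    ; _+_               = _+P_
    ; _*_               = _⋆_
    ; -_                = λ p i → - p i
    ; 0#                = λ _ → 0ℤ
    ; 1#                = X^ 0
    ; isCommutativeRing = record
      { isRing = record
        { +-isAbelianGroup = Pointwise.isAbelianGroup ℕ ℤ.+-0-isAbelianGroup
        ; *-cong           = ⋆-cong
        ; *-assoc          = ⋆-assoc
        ; *-identity       = ⋆-identityˡ , ⋆-identityʳ
        ; distrib          = ⋆-distribˡ , ⋆-distribʳ
        }
      ; *-comm = ⋆-comm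
      }
    }

module _ {c ℓ} (R : CommutativeRing c ℓ) where
  open import Data.Nat using (suc)
  open import Data.Maybe using (nothing)
  open CommutativeRing R
  open import Relation.Binary.Reasoning.Setoid setoid
  open import Algebra.Properties.AbelianGroup +-abelianGroup using (//-rightDividesʳ)
  open import Algebra.Solver.Ring.NaturalCoefficients commutativeSemiring (λ _ _ → nothing)
    using (solve; _:=_; _:+_; _:*_)

  sum-of-geometric⇒recurrence : ∀ a b (u v p : ℕ → Carrier) →
    (∀ k → u (suc k) ≈ a * u k) → (∀ k → v (suc k) ≈ b * v k) → (∀ k → p k ≈ u k + v k) →
    ∀ k → p (suc (suc k)) ≈ (a + b) * p (suc k) - (a * b) * p k
  sum-of-geometric⇒recurrence a b u v p u-step v-step p≈u+v k = begin
    p (suc (suc k))                                        ≈⟨ p-step (suc k) ⟩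
    a * u (suc k) + b * v (suc k)                          ≈⟨ +-cong (*-congˡ (u-step k)) (*-congˡ (v-step k)) ⟩
    a * (a * u k) + b * (b * v k)                          ≈⟨ sym (//-rightDividesʳ _ _) ⟩
    a * (a * u k) + b * (b * v k) + (a * b) * (u k + v k) - (a * b) * (u k + v k)
                                                           ≈⟨ +-congʳ (expand a b (u k) (v k)) ⟩
    (a + b) * (a * u k + b * v k) - (a * b) * (u k + v k)
                                                           ≈⟨ +-cong (*-congˡ (sym (p-step k))) (-‿cong (*-congˡ (sym (p≈u+v k)))) ⟩
    (a + b) * p (suc k) - (a * b) * p k                    ∎
    where
    p-step : ∀ k → p (suc k) ≈ a * u k + b * v k
    p-step k = trans (p≈u+v (suc k)) (+-cong (u-step k) (v-step k))
    -- The solver handles commutative semirings only, hence the subtraction is split off above.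
    expand : ∀ a b x y → a * (a * x) + b * (b * y) + (a * b) * (x + y) ≈ (a + b) * (a * x + b * y)
    expand = solve 4 (λ a b x y → a :* (a :* x) :+ b :* (b :* y) :+ (a :* b) :* (x :+ y)
                                  := (a :+ b) :* (a :* x :+ b :* y)) refl

module SubsetSum {c ℓ} (R : CommutativeSemiring c ℓ) where
  open import Data.Nat using (zero; suc; _+_)
  open import Data.Bool using (Bool; true; false)
  open import Data.Fin using (Fin; zero; suc)
  open import Data.Vec using (Vec; []; _∷_; _++_; insertAt)
  open CommutativeSemiring R renaming (_+_ to _⊕_)
  open import Algebra.Properties.CommutativeSemigroup +-commutativeSemigroup using (interchange)

  Σ⊆ : ∀ m → (Vec Bool m → Carrier) → Carrier
  Σ⊆ zero    f = f []
  Σ⊆ (suc m) f = Σ⊆ m (λ s → f (true ∷ s)) ⊕ Σ⊆ m (λ s → f (false ∷ s))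

  Σ⊆-cong : ∀ m {f g : Vec Bool m → Carrier} → (∀ s → f s ≈ g s) → Σ⊆ m f ≈ Σ⊆ m g
  Σ⊆-cong zero    f≈g = f≈g []
  Σ⊆-cong (suc m) f≈g = +-cong (Σ⊆-cong m (f≈g ∘ (true ∷_))) (Σ⊆-cong m (f≈g ∘ (false ∷_)))

  Σ⊆-zero : ∀ m → Σ⊆ m (λ _ → 0#) ≈ 0#
  Σ⊆-zero zero    = refl
  Σ⊆-zero (suc m) = trans (+-cong (Σ⊆-zero m) (Σ⊆-zero m)) (+-identityˡ 0#)

  Σ⊆-distrib-+ : ∀ m (f g : Vec Bool m → Carrier) → Σ⊆ m (λ s → f s ⊕ g s) ≈ Σ⊆ m f ⊕ Σ⊆ m g
  Σ⊆-distrib-+ zero    f g = refl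
  Σ⊆-distrib-+ (suc m) f g = trans (+-cong (Σ⊆-distrib-+ m _ _) (Σ⊆-distrib-+ m _ _)) (interchange _ _ _ _)

  *-distribˡ-Σ⊆ : ∀ m x (f : Vec Bool m → Carrier) → x * Σ⊆ m f ≈ Σ⊆ m (λ s → x * f s)
  *-distribˡ-Σ⊆ zero    x f = refl
  *-distribˡ-Σ⊆ (suc m) x f = trans (distribˡ x _ _) (+-cong (*-distribˡ-Σ⊆ m x _) (*-distribˡ-Σ⊆ m x _))

  *-distribʳ-Σ⊆ : ∀ m x (f : Vec Bool m → Carrier) → Σ⊆ m f * x ≈ Σ⊆ m (λ s → f s * x)
  *-distribʳ-Σ⊆ zero    x f = refl
  *-distribʳ-Σ⊆ (suc m) x f = trans (distribʳ x _ _) (+-cong (*-distribʳ-Σ⊆ m x _) (*-distribʳ-Σ⊆ m x _))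

  Σ⊆-++ : ∀ m k (f : Vec Bool (m + k) → Carrier) → Σ⊆ (m + k) f ≈ Σ⊆ m (λ s → Σ⊆ k (λ t → f (s ++ t)))
  Σ⊆-++ zero    k f = refl
  Σ⊆-++ (suc m) k f = +-cong (Σ⊆-++ m k _) (Σ⊆-++ m k _)

  Σ⊆-*-Σ⊆ : ∀ m k (f : Vec Bool m → Carrier) (g : Vec Bool k → Carrier) →
            Σ⊆ m f * Σ⊆ k g ≈ Σ⊆ m (λ s → Σ⊆ k (λ t → f s * g t))
  Σ⊆-*-Σ⊆ m k f g = trans (*-distribʳ-Σ⊆ m (Σ⊆ k g) f) (Σ⊆-cong m (λ s → *-distribˡ-Σ⊆ k (f s) g))

  Σ⊆-insertAt : ∀ m (w : Fin (suc m)) (f : Vec Bool (suc m) → Carrier) →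
                Σ⊆ (suc m) f ≈ Σ⊆ m (λ s → f (insertAt s w true)) ⊕ Σ⊆ m (λ s → f (insertAt s w false))
  Σ⊆-insertAt m       zero    f = refl
  Σ⊆-insertAt (suc m) (suc w) f =
    trans (+-cong (Σ⊆-insertAt m w (λ s → f (true ∷ s))) (Σ⊆-insertAt m w (λ s → f (false ∷ s))))
          (interchange _ _ _ _)

module SizePolynomial where
  open import Data.Nat as ℕ using (zero; suc; _≡ᵇ_)
  import Data.Nat.Properties as ℕP
  open import Data.Integer as ℤ using (+_)
  import Data.Integer.Properties as ℤP
  open import Data.Bool using (Bool; true; false; _∧_; if_then_else_)
  open import Data.Bool.Properties using (∧-zeroʳ; ∧-identityʳ)
  open import Data.Fin using (zero; suc)
  open import Data.List as List using (List; []; _∷_)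
  import Data.List.Properties as List
  open import Data.Vec using (Vec; []; _∷_; _++_; insertAt)
  open import Relation.Nullary.Decidable using (⌊_⌋; isYes≗does)
  open import Relation.Binary.PropositionalEquality as ≡ using (cong; cong₂)
  open PowerSeries using (X^_; X^-+; commutativeRing)
  open CommutativeRing commutativeRing
  open SubsetSum commutativeSemiring

  weight : Bool → ℕ → Poly
  weight b a = if b then X^ a else 0#

  weight-∧ : ∀ b c x y → weight (b ∧ c) (x ℕ.+ y) ≈ weight b x * weight c y
  weight-∧ false c     x y = sym (zeroˡ (weight c y))
  weight-∧ true  false x y = sym (zeroʳ (X^ x))
  weight-∧ true  true  x y = sym (X^-+ x y)

  weighted : ∀ {m} → (Vec Bool m → Bool) → Vec Bool m → Poly
  weighted P s = weight (P s) (size s)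

  sizePoly : ∀ m → (Vec Bool m → Bool) → Poly
  sizePoly m P = Σ⊆ m (weighted P)

  sizePoly-cong : ∀ m {P Q : Vec Bool m → Bool} → (∀ s → P s ≡ Q s) → sizePoly m P ≈ sizePoly m Q
  sizePoly-cong m P≗Q = Σ⊆-cong m (λ s → reflexive (cong (λ b → weight b (size s)) (P≗Q s)))

  weight-factor : ∀ c d y z {b x} → b ≡ (c ∧ d) → x ≡ y ℕ.+ z → weight b x ≈ weight c y * weight d z
  weight-factor c d y z ≡.refl ≡.refl = weight-∧ c d y z

  size-++ : ∀ {a b} (x : Vec Bool a) (y : Vec Bool b) → size (x ++ y) ≡ size x ℕ.+ size y
  size-++ []          y = ≡.refl
  size-++ (true  ∷ x) y = cong suc (size-++ x y)
  size-++ (false ∷ x) y = size-++ x y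

  size-∷-++ : ∀ {a b} c (x : Vec Bool a) (y : Vec Bool b) → size (c ∷ x ++ y) ≡ size x ℕ.+ size (c ∷ y)
  size-∷-++ true  x y = ≡.trans (cong suc (size-++ x y)) (≡.sym (ℕP.+-suc (size x) (size y)))
  size-∷-++ false x y = size-++ x y

  size-insertAt-false : ∀ {m} (s : Vec Bool m) w → size (insertAt s w false) ≡ size s
  size-insertAt-false s           zero    = ≡.refl
  size-insertAt-false (true  ∷ s) (suc w) = cong suc (size-insertAt-false s w)
  size-insertAt-false (false ∷ s) (suc w) = size-insertAt-false s w

  sumℤ-++ : ∀ xs ys → sumℤ (xs List.++ ys) ≡ sumℤ xs ℤ.+ sumℤ ys
  sumℤ-++ []       ys = ≡.sym (ℤP.+-identityˡ _)
  sumℤ-++ (x ∷ xs) ys = ≡.trans (cong (ℤ._+_ x) (sumℤ-++ xs ys)) (≡.sym (ℤP.+-assoc x _ _))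

  sumℤ-subsets : ∀ m (f : Vec Bool m → Poly) i → sumℤ (List.map (λ s → f s i) (subsets m)) ≡ Σ⊆ m f i
  sumℤ-subsets zero    f i = ℤP.+-identityʳ (f [] i)
  sumℤ-subsets (suc m) f i = begin
    sumℤ (List.map g (List.map (true ∷_) S List.++ List.map (false ∷_) S))
      ≡⟨ cong sumℤ (List.map-++ g (List.map (true ∷_) S) _) ⟩
    sumℤ (List.map g (List.map (true ∷_) S) List.++ List.map g (List.map (false ∷_) S))
      ≡⟨ sumℤ-++ (List.map g (List.map (true ∷_) S)) _ ⟩
    sumℤ (List.map g (List.map (true ∷_) S)) ℤ.+ sumℤ (List.map g (List.map (false ∷_) S))
      ≡⟨ cong₂ ℤ._+_ (cong sumℤ (≡.sym (List.map-∘ S))) (cong sumℤ (≡.sym (List.map-∘ S))) ⟩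
    sumℤ (List.map (λ s → f (true ∷ s) i) S) ℤ.+ sumℤ (List.map (λ s → f (false ∷ s) i) S)
      ≡⟨ cong₂ ℤ._+_ (sumℤ-subsets m (λ s → f (true ∷ s)) i) (sumℤ-subsets m (λ s → f (false ∷ s)) i) ⟩
    Σ⊆ (suc m) f i ∎
    where
    open ≡.≡-Reasoning
    S : List (Vec Bool m)
    S = subsets m
    g : Vec Bool (suc m) → ℤ.ℤ
    g s = f s i

  countTrue-step : ∀ a i b c → + (if ⌊ a ℕP.≟ i ⌋ ∧ b then suc c else c) ≡ weight b a i ℤ.+ + c
  countTrue-step a i false c rewrite ∧-zeroʳ ⌊ a ℕP.≟ i ⌋ = ≡.sym (ℤP.+-identityˡ _)
  countTrue-step a i true  c rewrite ∧-identityʳ ⌊ a ℕP.≟ i ⌋ | isYes≗does (a ℕP.≟ i) with a ≡ᵇ i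
  ... | true  = ≡.refl
  ... | false = ≡.sym (ℤP.+-identityˡ _)

  countTrue≡sumℤ-weighted : ∀ {m} (P : Vec Bool m → Bool) i (L : List (Vec Bool m)) →
    + countTrue (λ s → ⌊ size s ℕP.≟ i ⌋ ∧ P s) L ≡ sumℤ (List.map (λ s → weighted P s i) L)
  countTrue≡sumℤ-weighted P i []      = ≡.refl
  countTrue≡sumℤ-weighted P i (s ∷ L) =
    ≡.trans (countTrue-step (size s) i (P s) _) (cong (ℤ._+_ (weighted P s i)) (countTrue≡sumℤ-weighted P i L))

  I≈sizePoly : ∀ G → I G ≈ sizePoly (n G) (isIndependent G)
  I≈sizePoly G i = ≡.trans (countTrue≡sumℤ-weighted (isIndependent G) i (subsets (n G)))
                           (sumℤ-subsets (n G) (weighted (isIndependent G)) i)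

module Independence where
  open import Data.Nat as ℕ using (suc)
  open import Data.Bool using (Bool; true; false; T; _∧_)
  open import Data.Bool.Properties using (T-∧; ∧-identityʳ; ∧-zeroʳ; ∧-comm)
  open import Data.Empty using (⊥-elim)
  open import Data.Fin using (Fin; zero; suc; _↑ˡ_; _↑ʳ_; splitAt; remQuot; punchIn; punchOut)
  import Data.Fin.Properties as Fin
  open import Data.List using ([]; _∷_)
  open import Data.List.Relation.Unary.All using (All; []; _∷_)
  open import Data.List.Relation.Unary.All.Properties using (tabulate⁺; tabulate⁻)
  open import Data.Product using (_,_; ∃; proj₁; proj₂)
  open import Data.Sum using (_⊎_; inj₁; inj₂)
  open import Data.Vec using (Vec; _∷_; lookup; _++_; insertAt)
  import Data.Vec.Properties as Vec
  open import Function using (_⇔_; mk⇔; Equivalence)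
  open import Relation.Nullary.Decidable using (yes; no; isYes; ⌊⌋-map′)
  open import Relation.Binary.PropositionalEquality
    using (refl; sym; trans; cong; subst; ≡-≟-identity)

  T-ext : ∀ {x y} → (T x → T y) → (T y → T x) → x ≡ y
  T-ext {false} {false} _   _   = refl
  T-ext {false} {true}  _   y⇒x = ⊥-elim (y⇒x _)
  T-ext {true}  {false} x⇒y _   = ⊥-elim (x⇒y _)
  T-ext {true}  {true}  _   _   = refl

  T-allB : ∀ {A : Set} (f : A → Bool) xs → T (allB f xs) ⇔ All (T ∘ f) xs
  T-allB f []       = mk⇔ (λ _ → []) (λ _ → _)
  T-allB f (x ∷ xs) = mk⇔
    (λ h → let fx , rest = Equivalence.to T-∧ h in fx ∷ Equivalence.to (T-allB f xs) rest)
    (λ { (fx ∷ rest) → Equivalence.from T-∧ (fx , Equivalence.from (T-allB f xs) rest) })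

  compatible : (G : Graph) → Vec Bool (n G) → Fin (n G) → Fin (n G) → Bool
  compatible G s u v = not (lookup s u ∧ lookup s v ∧ adj G u v)

  Independent : (G : Graph) → Vec Bool (n G) → Set
  Independent G s = ∀ u v → T (compatible G s u v)

  isIndependent⇔ : ∀ G s → T (isIndependent G s) ⇔ Independent G s
  isIndependent⇔ G s = mk⇔
    (λ h u v → tabulate⁻ (Equivalence.to (T-allB _ _) (tabulate⁻ (Equivalence.to (T-allB _ _) h) u)) v)
    (λ h → Equivalence.from (T-allB _ _) (tabulate⁺ (λ u → Equivalence.from (T-allB _ _) (tabulate⁺ (h u)))))

  eqF-refl : ∀ {m} (a : Fin m) → eqF a a ≡ true
  eqF-refl a = cong isYes (≡-≟-identity Fin._≟_ refl)

  ↑ˡ-or-↑ʳ : ∀ m {k} (x : Fin (m ℕ.+ k)) → (∃ λ i → x ≡ i ↑ˡ k) ⊎ (∃ λ j → x ≡ m ↑ʳ j)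
  ↑ˡ-or-↑ʳ m {k} x with splitAt m x in eq
  ... | inj₁ i = inj₁ (i , sym (Fin.splitAt⁻¹-↑ˡ eq))
  ... | inj₂ j = inj₂ (j , sym (Fin.splitAt⁻¹-↑ʳ eq))

  record IsEdgeJoin (Γ G : Graph) (a : Fin (n G)) (K : Graph) (b : Fin (n K)) : Set where
    field
      inl         : Fin (n G) → Fin (n Γ)
      inr         : Fin (n K) → Fin (n Γ)
      inl-or-inr  : ∀ x → (∃ λ u → x ≡ inl u) ⊎ (∃ λ v → x ≡ inr v)
      adj-inl-inl : ∀ u u′ → adj Γ (inl u) (inl u′) ≡ adj G u u′
      adj-inr-inr : ∀ v v′ → adj Γ (inr v) (inr v′) ≡ adj K v v′
      adj-inl-inr : ∀ u v → adj Γ (inl u) (inr v) ≡ eqF u a ∧ eqF v b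
      adj-inr-inl : ∀ v u → adj Γ (inr v) (inl u) ≡ eqF v b ∧ eqF u a

  module _ {Γ G K a b} (J : IsEdgeJoin Γ G a K b) (σ : Vec Bool (n Γ)) s t
           (σ-inl : ∀ u → lookup σ (IsEdgeJoin.inl J u) ≡ lookup s u)
           (σ-inr : ∀ v → lookup σ (IsEdgeJoin.inr J v) ≡ lookup t v) where
    open IsEdgeJoin J

    private
      compatible-inl-inl : ∀ u u′ → compatible Γ σ (inl u) (inl u′) ≡ compatible G s u u′
      compatible-inl-inl u u′ rewrite σ-inl u | σ-inl u′ | adj-inl-inl u u′ = refl

      compatible-inr-inr : ∀ v v′ → compatible Γ σ (inr v) (inr v′) ≡ compatible K t v v′
      compatible-inr-inr v v′ rewrite σ-inr v | σ-inr v′ | adj-inr-inr v v′ = refl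

      compatible-inl-inr : ∀ u v → compatible Γ σ (inl u) (inr v)
                                   ≡ not (lookup s u ∧ lookup t v ∧ (eqF u a ∧ eqF v b))
      compatible-inl-inr u v rewrite σ-inl u | σ-inr v | adj-inl-inr u v = refl

      compatible-inr-inl : ∀ v u → compatible Γ σ (inr v) (inl u)
                                   ≡ not (lookup t v ∧ lookup s u ∧ (eqF v b ∧ eqF u a))
      compatible-inr-inl v u rewrite σ-inl u | σ-inr v | adj-inr-inl v u = refl

      across-compatible : ∀ {m k} (x : Fin m → Bool) (y : Fin k → Bool) {a b} u v →
                  T (not (x a ∧ y b)) → T (not (x u ∧ y v ∧ (eqF u a ∧ eqF v b)))
      across-compatible x y {a} {b} u v h with u Fin.≟ a | v Fin.≟ b
      ... | yes refl | yes refl rewrite ∧-identityʳ (y v) = h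
      ... | yes _    | no _     rewrite ∧-zeroʳ (y v) | ∧-zeroʳ (x u) = _
      ... | no _     | _        rewrite ∧-zeroʳ (y v) | ∧-zeroʳ (x u) = _

      not-both-ends : T (compatible Γ σ (inl a) (inr b)) → T (not (lookup s a ∧ lookup t b))
      not-both-ends = subst T (trans (compatible-inl-inr a b) a-and-b)
        where
        a-and-b : not (lookup s a ∧ lookup t b ∧ (eqF a a ∧ eqF b b)) ≡ not (lookup s a ∧ lookup t b)
        a-and-b rewrite eqF-refl a | eqF-refl b | ∧-identityʳ (lookup t b) = refl

    edgeJoin-independent :
      isIndependent Γ σ ≡ ((isIndependent G s ∧ not (lookup s a ∧ lookup t b)) ∧ isIndependent K t)
    edgeJoin-independent = T-ext to from
      where
      to : T (isIndependent Γ σ) → T ((isIndependent G s ∧ not (lookup s a ∧ lookup t b)) ∧ isIndependent K t)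
      to h = Equivalence.from T-∧ (Equivalence.from T-∧ (hG , not-both-ends (hΓ (inl a) (inr b))) , hK)
        where
        hΓ : Independent Γ σ
        hΓ = Equivalence.to (isIndependent⇔ Γ σ) h
        hG : T (isIndependent G s)
        hG = Equivalence.from (isIndependent⇔ G s) (λ u u′ → subst T (compatible-inl-inl u u′) (hΓ (inl u) (inl u′)))
        hK : T (isIndependent K t)
        hK = Equivalence.from (isIndependent⇔ K t) (λ v v′ → subst T (compatible-inr-inr v v′) (hΓ (inr v) (inr v′)))

      from : T ((isIndependent G s ∧ not (lookup s a ∧ lookup t b)) ∧ isIndependent K t) → T (isIndependent Γ σ)
      from h = Equivalence.from (isIndependent⇔ Γ σ) hΓ
        where
        h₁ : T (isIndependent G s ∧ not (lookup s a ∧ lookup t b))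
        h₁ = proj₁ (Equivalence.to T-∧ h)
        hG : Independent G s
        hG = Equivalence.to (isIndependent⇔ G s) (proj₁ (Equivalence.to T-∧ h₁))
        hK : Independent K t
        hK = Equivalence.to (isIndependent⇔ K t) (proj₂ (Equivalence.to T-∧ h))
        hab : T (not (lookup s a ∧ lookup t b))
        hab = proj₂ (Equivalence.to T-∧ h₁)
        hba : T (not (lookup t b ∧ lookup s a))
        hba = subst T (cong not (∧-comm (lookup s a) (lookup t b))) hab
        hΓ : Independent Γ σ
        hΓ x y with inl-or-inr x | inl-or-inr y
        ... | inj₁ (u , refl) | inj₁ (u′ , refl) = subst T (sym (compatible-inl-inl u u′)) (hG u u′)
        ... | inj₂ (v , refl) | inj₂ (v′ , refl) = subst T (sym (compatible-inr-inr v v′)) (hK v v′)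
        ... | inj₁ (u , refl) | inj₂ (v , refl)  =
          subst T (sym (compatible-inl-inr u v)) (across-compatible (lookup s) (lookup t) u v hab)
        ... | inj₂ (v , refl) | inj₁ (u , refl)  =
          subst T (sym (compatible-inr-inl v u)) (across-compatible (lookup t) (lookup s) v u hba)

  joinByEdge-isEdgeJoin : ∀ G a K b → IsEdgeJoin (joinByEdge G a K b) G a K b
  joinByEdge-isEdgeJoin G a K b = record
    { inl         = _↑ˡ n K
    ; inr         = n G ↑ʳ_
    ; inl-or-inr  = ↑ˡ-or-↑ʳ (n G)
    ; adj-inl-inl = adj-ll
    ; adj-inr-inr = adj-rr
    ; adj-inl-inr = adj-lr
    ; adj-inr-inl = adj-rl
    }
    where
    Γ : Graph
    Γ = joinByEdge G a K b
    adj-ll : ∀ u u′ → adj Γ (u ↑ˡ n K) (u′ ↑ˡ n K) ≡ adj G u u′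
    adj-ll u u′ rewrite Fin.splitAt-↑ˡ (n G) u (n K) | Fin.splitAt-↑ˡ (n G) u′ (n K) = refl
    adj-rr : ∀ v v′ → adj Γ (n G ↑ʳ v) (n G ↑ʳ v′) ≡ adj K v v′
    adj-rr v v′ rewrite Fin.splitAt-↑ʳ (n G) (n K) v | Fin.splitAt-↑ʳ (n G) (n K) v′ = refl
    adj-lr : ∀ u v → adj Γ (u ↑ˡ n K) (n G ↑ʳ v) ≡ eqF u a ∧ eqF v b
    adj-lr u v rewrite Fin.splitAt-↑ˡ (n G) u (n K) | Fin.splitAt-↑ʳ (n G) (n K) v = refl
    adj-rl : ∀ v u → adj Γ (n G ↑ʳ v) (u ↑ˡ n K) ≡ eqF v b ∧ eqF u a
    adj-rl v u rewrite Fin.splitAt-↑ʳ (n G) (n K) v | Fin.splitAt-↑ˡ (n G) u (n K) = refl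

  join-independent : ∀ G a K b (s : Vec Bool (n G)) (t : Vec Bool (n K)) →
    isIndependent (joinByEdge G a K b) (s ++ t)
      ≡ ((isIndependent G s ∧ not (lookup s a ∧ lookup t b)) ∧ isIndependent K t)
  join-independent G a K b s t =
    edgeJoin-independent (joinByEdge-isEdgeJoin G a K b) (s ++ t) s t (Vec.lookup-++ˡ s t) (Vec.lookup-++ʳ s t)

  module _ (H : Graph) (w : Fin (n H)) (k : ℕ) where
    private
      N : ℕ
      N = k ℕ.* n H
      Z Z′ : Graph
      Z  = scale k (rooted H w)
      Z′ = scale (suc k) (rooted H w)

      first : Fin (n H) → Fin (n Z′)
      first j = suc (j ↑ˡ N)

      rest : Fin (n Z) → Fin (n Z′)
      rest zero    = zero
      rest (suc y) = suc (n H ↑ʳ y)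

      first-or-rest : ∀ x → (∃ λ j → x ≡ first j) ⊎ (∃ λ y → x ≡ rest y)
      first-or-rest zero = inj₂ (zero , refl)
      first-or-rest (suc x) with ↑ˡ-or-↑ʳ (n H) x
      ... | inj₁ (j , refl) = inj₁ (j , refl)
      ... | inj₂ (y , refl) = inj₂ (suc y , refl)

      adj-ff : ∀ i j → adj Z′ (first i) (first j) ≡ adj H i j
      adj-ff i j rewrite Fin.splitAt-↑ˡ (n H) i N | Fin.splitAt-↑ˡ (n H) j N = refl

      adj-rr : ∀ x y → adj Z′ (rest x) (rest y) ≡ adj Z x y
      adj-rr zero    zero    = refl
      adj-rr zero    (suc y) rewrite Fin.splitAt-↑ʳ (n H) N y = refl
      adj-rr (suc x) zero    rewrite Fin.splitAt-↑ʳ (n H) N x = refl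
      adj-rr (suc x) (suc y) rewrite Fin.splitAt-↑ʳ (n H) N x | Fin.splitAt-↑ʳ (n H) N y =
        cong (_∧ adj H (proj₂ (remQuot {k} (n H) x)) (proj₂ (remQuot {k} (n H) y)))
             (⌊⌋-map′ _ _ (proj₁ (remQuot {k} (n H) x) Fin.≟ proj₁ (remQuot {k} (n H) y)))

      adj-fr : ∀ j y → adj Z′ (first j) (rest y) ≡ eqF j w ∧ eqF y zero
      adj-fr j zero    rewrite Fin.splitAt-↑ˡ (n H) j N = sym (∧-identityʳ _)
      adj-fr j (suc y) rewrite Fin.splitAt-↑ˡ (n H) j N | Fin.splitAt-↑ʳ (n H) N y = sym (∧-zeroʳ _)

      adj-rf : ∀ y j → adj Z′ (rest y) (first j) ≡ eqF y zero ∧ eqF j w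
      adj-rf zero    j rewrite Fin.splitAt-↑ˡ (n H) j N = refl
      adj-rf (suc y) j rewrite Fin.splitAt-↑ˡ (n H) j N | Fin.splitAt-↑ʳ (n H) N y = refl

    -- Z_{k+1}(H^w) is a copy of H joined to Z_k(H^w) by the edge from w to the centre.
    scale-isEdgeJoin : IsEdgeJoin Z′ H w Z zero
    scale-isEdgeJoin = record
      { inl = first ; inr = rest ; inl-or-inr = first-or-rest
      ; adj-inl-inl = adj-ff ; adj-inr-inr = adj-rr ; adj-inl-inr = adj-fr ; adj-inr-inl = adj-rf
      }

    scale-independent : ∀ c (t : Vec Bool (n H)) (s : Vec Bool N) →
      isIndependent Z′ (c ∷ t ++ s) ≡ ((isIndependent H t ∧ not (c ∧ lookup t w)) ∧ isIndependent Z (c ∷ s))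
    scale-independent c t s =
      trans (edgeJoin-independent scale-isEdgeJoin (c ∷ t ++ s) t (c ∷ s) σ-first σ-rest)
            (cong (λ x → (isIndependent H t ∧ not x) ∧ isIndependent Z (c ∷ s)) (∧-comm (lookup t w) c))
      where
      σ-first : ∀ j → lookup (c ∷ t ++ s) (first j) ≡ lookup t j
      σ-first = Vec.lookup-++ˡ t s
      σ-rest : ∀ y → lookup (c ∷ t ++ s) (rest y) ≡ lookup (c ∷ s) y
      σ-rest zero    = refl
      σ-rest (suc y) = Vec.lookup-++ʳ t s y

  w-or-punchIn : ∀ {m} (w u : Fin (suc m)) → u ≡ w ⊎ ∃ λ i → u ≡ punchIn w i
  w-or-punchIn w u with u Fin.≟ w
  ... | yes u≡w = inj₁ u≡w
  ... | no  u≢w = inj₂ (punchOut (u≢w ∘ sym) , sym (Fin.punchIn-punchOut (u≢w ∘ sym)))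

  deleteV-independent : ∀ m (a : Fin (suc m) → Fin (suc m) → Bool) w (s : Vec Bool m) →
    isIndependent (mkGraph (suc m) a) (insertAt s w false) ≡ isIndependent (deleteV (mkGraph (suc m) a) w) s
  deleteV-independent m a w s = T-ext to from
    where
    H H∖w : Graph
    H   = mkGraph (suc m) a
    H∖w = deleteV H w
    s′ : Vec Bool (suc m)
    s′ = insertAt s w false

    compatible-punchIn : ∀ i j → compatible H s′ (punchIn w i) (punchIn w j) ≡ compatible H∖w s i j
    compatible-punchIn i j rewrite Vec.insertAt-punchIn s w false i | Vec.insertAt-punchIn s w false j = refl

    to : T (isIndependent H s′) → T (isIndependent H∖w s)
    to h = Equivalence.from (isIndependent⇔ H∖w s)
      (λ i j → subst T (compatible-punchIn i j) (Equivalence.to (isIndependent⇔ H s′) h (punchIn w i) (punchIn w j)))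

    from : T (isIndependent H∖w s) → T (isIndependent H s′)
    from h = Equivalence.from (isIndependent⇔ H s′) hH
      where
      hH : Independent H s′
      hH u v with w-or-punchIn w u | w-or-punchIn w v
      ... | inj₁ refl | _ rewrite Vec.insertAt-lookup s w false = _
      ... | inj₂ _ | inj₁ refl rewrite Vec.insertAt-lookup s w false | ∧-zeroʳ (lookup s′ u) = _
      ... | inj₂ (i , refl) | inj₂ (j , refl) =
        subst T (sym (compatible-punchIn i j)) (Equivalence.to (isIndependent⇔ H∖w s) h i j)

module IndependencePolynomial where
  open import Data.Nat as ℕ using (suc)
  open import Data.Bool using (Bool; true; false; _∧_)
  open import Data.Bool.Properties using (∧-zeroʳ; ∧-identityʳ)
  open import Data.Fin using (Fin; zero)
  open import Data.Vec using (Vec; _∷_; _++_; lookup; insertAt)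
  import Data.Vec.Properties as Vec
  open PowerSeries using (commutativeRing)
  open CommutativeRing commutativeRing hiding (zero)
  open import Algebra.Properties.CommutativeSemigroup *-commutativeSemigroup using (x∙yz≈y∙xz)
  open import Relation.Binary.Reasoning.Setoid setoid
  open SubsetSum commutativeSemiring
  open SizePolynomial
  open Independence using (join-independent; scale-independent; deleteV-independent)

  I-deleteV : ∀ m a (w : Fin (suc m)) →
    sizePoly (suc m) (λ t → isIndependent (mkGraph (suc m) a) t ∧ not (lookup t w))
      ≈ I (deleteV (mkGraph (suc m) a) w)
  I-deleteV m a w = begin
    Σ⊆ (suc m) (weighted P)
      ≈⟨ Σ⊆-insertAt m w (weighted P) ⟩
    Σ⊆ m (λ s → weighted P (insertAt s w true)) + Σ⊆ m (λ s → weighted P (insertAt s w false))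
      ≈⟨ +-cong (trans (Σ⊆-cong m w-chosen) (Σ⊆-zero m)) (Σ⊆-cong m w-avoided) ⟩
    0# + sizePoly m (isIndependent H∖w)
      ≈⟨ +-identityˡ _ ⟩
    sizePoly m (isIndependent H∖w)
      ≈⟨ sym (I≈sizePoly H∖w) ⟩
    I H∖w
      ∎
    where
    H H∖w : Graph
    H   = mkGraph (suc m) a
    H∖w = deleteV H w
    P : Vec Bool (suc m) → Bool
    P t = isIndependent H t ∧ not (lookup t w)
    w-chosen : ∀ s → weighted P (insertAt s w true) ≈ 0#
    w-chosen s rewrite Vec.insertAt-lookup s w true | ∧-zeroʳ (isIndependent H (insertAt s w true)) = refl
    w-avoided : ∀ s → weighted P (insertAt s w false) ≈ weighted (isIndependent H∖w) s
    w-avoided s rewrite Vec.insertAt-lookup s w false | ∧-identityʳ (isIndependent H (insertAt s w false))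
                      | deleteV-independent m a w s | size-insertAt-false s w = refl

  -- The Boolean c records whether the centre v₀ of Z_k(H^w) is chosen.
  module Colon (G : Graph) (v : Fin (n G)) (H : Graph) (w : Fin (n H)) where

    Z : ℕ → Graph
    Z k = scale k (rooted H w)

    G-avoiding : Bool → Vec Bool (n G) → Bool
    G-avoiding c s = isIndependent G s ∧ not (lookup s v ∧ c)

    H-avoiding : Bool → Vec Bool (n H) → Bool
    H-avoiding c t = isIndependent H t ∧ not (c ∧ lookup t w)

    G-part H-part : Bool → Poly
    G-part c = sizePoly (n G) (G-avoiding c)
    H-part c = sizePoly (n H) (H-avoiding c)

    Z-part : Bool → ℕ → Poly
    Z-part c k = Σ⊆ (k ℕ.* n H) (λ s → weighted (isIndependent (Z k)) (c ∷ s))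

    weighted-join : ∀ k c s t → weighted (isIndependent (colon (rooted G v) (rooted H w) k)) (s ++ c ∷ t)
                                ≈ weighted (G-avoiding c) s * weighted (isIndependent (Z k)) (c ∷ t)
    weighted-join k c s t =
      weight-factor (G-avoiding c s) (isIndependent (Z k) (c ∷ t)) (size s) (size (c ∷ t))
                    (join-independent G v (Z k) zero s (c ∷ t)) (size-++ s (c ∷ t))

    weighted-scale : ∀ k c t s → weighted (isIndependent (Z (suc k))) (c ∷ t ++ s)
                                 ≈ weighted (H-avoiding c) t * weighted (isIndependent (Z k)) (c ∷ s)
    weighted-scale k c t s =
      weight-factor (H-avoiding c t) (isIndependent (Z k) (c ∷ s)) (size t) (size (c ∷ s))
                    (scale-independent H w k c t s) (size-∷-++ c t s)

    I-colon : ∀ k → I (colon (rooted G v) (rooted H w) k) ≈ G-part true * Z-part true k + G-part false * Z-part false k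
    I-colon k = begin
      I Γ                                                                 ≈⟨ I≈sizePoly Γ ⟩
      Σ⊆ (n G ℕ.+ suc N) (weighted (isIndependent Γ))                      ≈⟨ Σ⊆-++ (n G) (suc N) _ ⟩
      Σ⊆ (n G) (λ s → Σ⊆ N (f true s) + Σ⊆ N (f false s))                  ≈⟨ Σ⊆-distrib-+ (n G) _ _ ⟩
      Σ⊆ (n G) (λ s → Σ⊆ N (f true s)) + Σ⊆ (n G) (λ s → Σ⊆ N (f false s))  ≈⟨ +-cong (factor true) (factor false) ⟩
      G-part true * Z-part true k + G-part false * Z-part false k          ∎
      where
      N : ℕ
      N = k ℕ.* n H
      Γ : Graph
      Γ = colon (rooted G v) (rooted H w) k
      f : Bool → Vec Bool (n G) → Vec Bool N → Poly
      f c s t = weighted (isIndependent Γ) (s ++ c ∷ t)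
      factor : ∀ c → Σ⊆ (n G) (λ s → Σ⊆ N (f c s)) ≈ G-part c * Z-part c k
      factor c = trans
        (Σ⊆-cong (n G) (λ s → Σ⊆-cong N (weighted-join k c s)))
        (sym (Σ⊆-*-Σ⊆ (n G) N (weighted (G-avoiding c)) (λ t → weighted (isIndependent (Z k)) (c ∷ t))))

    Z-part-suc : ∀ c k → Z-part c (suc k) ≈ H-part c * Z-part c k
    Z-part-suc c k = begin
      Z-part c (suc k)
        ≈⟨ Σ⊆-++ (n H) N _ ⟩
      Σ⊆ (n H) (λ t → Σ⊆ N (λ s → weighted (isIndependent (Z (suc k))) (c ∷ t ++ s)))
        ≈⟨ Σ⊆-cong (n H) (λ t → Σ⊆-cong N (weighted-scale k c t)) ⟩
      Σ⊆ (n H) (λ t → Σ⊆ N (λ s → weighted (H-avoiding c) t * weighted (isIndependent (Z k)) (c ∷ s)))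
        ≈⟨ sym (Σ⊆-*-Σ⊆ (n H) N (weighted (H-avoiding c)) (λ s → weighted (isIndependent (Z k)) (c ∷ s))) ⟩
      H-part c * Z-part c k
        ∎
      where
      N : ℕ
      N = k ℕ.* n H

    G-part*Z-part-suc : ∀ c k → G-part c * Z-part c (suc k) ≈ H-part c * (G-part c * Z-part c k)
    G-part*Z-part-suc c k = trans (*-congˡ {G-part c} (Z-part-suc c k)) (x∙yz≈y∙xz (G-part c) (H-part c) (Z-part c k))

    H-part-false : H-part false ≈ I H
    H-part-false = trans (sizePoly-cong (n H) (λ t → ∧-identityʳ (isIndependent H t))) (sym (I≈sizePoly H))

open import Data.Nat using (zero; suc; s≤s; z≤n)
open import Data.Bool using (true; false)
open PowerSeries using (commutativeRing; *P≈⋆)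
open IndependencePolynomial using (I-deleteV; module Colon)

theorem2p2 : (G H : RootedGraph) → IsSimple (graph G) → IsSimple (graph H) →
    (k : ℕ) → 2 ≤ k → (i : ℕ) →
    I (colon G H k) i ≡
      (((I (deleteV (graph H) (root H)) +P I (graph H)) *P I (colon G H (k ∸ 1)))
        -P ((I (deleteV (graph H) (root H)) *P I (graph H)) *P I (colon G H (k ∸ 2)))) i
theorem2p2 _ (rooted (mkGraph zero _) ()) _ _ _ _
theorem2p2 (rooted G v) (rooted H@(mkGraph (suc m) a) w) _ _ (suc (suc k)) (s≤s (s≤s z≤n)) = begin
  P (suc (suc k))
    ≈⟨ sum-of-geometric⇒recurrence commutativeRing D A containing-v₀ avoiding-v₀ P
                                   containing-v₀-suc avoiding-v₀-suc I-colon k ⟩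
  (D + A) * P (suc k) - (D * A) * P k
    ≈⟨ +-cong (sym (*P≈⋆ (D + A) (P (suc k))))
              (-‿cong (sym (trans (*P≈⋆ (D *P A) (P k)) (*-congʳ (*P≈⋆ D A))))) ⟩
  ((D + A) *P P (suc k)) -P ((D *P A) *P P k)
    ∎
  where
  open CommutativeRing commutativeRing
  open import Relation.Binary.Reasoning.Setoid setoid
  open Colon G v H w
  P : ℕ → Poly
  P = I ∘ colon (rooted G v) (rooted H w)
  D A : Poly
  D = I (deleteV H w)
  A = I H
  containing-v₀ avoiding-v₀ : ℕ → Poly
  containing-v₀ k = G-part true * Z-part true k
  avoiding-v₀   k = G-part false * Z-part false k
  containing-v₀-suc : ∀ k → containing-v₀ (suc k) ≈ D * containing-v₀ k
  containing-v₀-suc k = trans (G-part*Z-part-suc true k) (*-congʳ (I-deleteV m a w))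
  avoiding-v₀-suc : ∀ k → avoiding-v₀ (suc k) ≈ A * avoiding-v₀ k
  avoiding-v₀-suc k = trans (G-part*Z-part-suc false k) (*-congʳ H-part-false)
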